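{- Let $T$ be a finite rooted tree in which every inner node has at least two children, with leaf set $L$ and node set $V$. There exist four bi-colourings $(A_1,B_1),\dots,(A_4,B_4)$ of $L$ and a partition $(S_1,S_2,S_3,S_4)$ of $V\setminus L$ such that for each $i\in\{1,2,3,4\}$, $(A_i,B_i)$ identifies $S_i$.
   Context: A bi-colouring is a pair $(A,B)$ of disjoint subsets of $L$ of the same cardinality. A pair $(\pi,\sigma)$ of injective maps from $S\subseteq V\setminus L$ to $L$ identifies $S$ if for each $s\in S$, $s$ is the least common ancestor of $\pi(s)$ and $\sigma(s)$ (every node is its own ancestor); a node $x$ is $s$-requested if it lies on the path from $\pi(s)$ to $\sigma(s)$; the pair has unique request if every node is $s$-requested for at most one $s\in S$. A bi-colouring $(A,B)$ identifies $S$ if some pair $(\pi,\sigma)$ identifying $S$ with unique request satisfies $\pi(S)=A$, $\sigma(S)=B$. The sets $A_i$ for different $i$ need not be disjoint. -}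

module Defs where

open import Data.Nat using (ℕ)
open import Data.Fin using (Fin)
open import Data.List using (List; _∷_; length; lookup)
open import Data.Bool using (Bool; true; false)
open import Data.Product using (Σ; ∃; _×_; _,_; proj₁)
open import Data.Sum using (_⊎_)
open import Data.Empty using (⊥)
open import Relation.Binary.PropositionalEquality using (_≡_)
open import Function.Bundles using (_↔_; _⇔_)

-- Finite rooted trees in which every inner node has at least two children
-- (children t₁, t₂ and then the list ts).
data Tree : Set where
  leaf : Tree
  node : (t₁ t₂ : Tree) (ts : List Tree) → Tree

children : Tree → List Tree
children leaf = Data.List.[]
children (node t₁ t₂ ts) = t₁ ∷ t₂ ∷ ts

-- Nodes of a tree t (the set V), identified with their positions (root paths).
data Pos : Tree → Set where
  here  : ∀ {t} → Pos t
  there : ∀ {t₁ t₂ ts} (i : Fin (length (t₁ ∷ t₂ ∷ ts))) →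
          Pos (lookup (t₁ ∷ t₂ ∷ ts) i) → Pos (node t₁ t₂ ts)

subtree : ∀ {t} → Pos t → Tree
subtree {t} here = t
subtree (there i p) = subtree p

isLeafT : Tree → Bool
isLeafT leaf = true
isLeafT (node _ _ _) = false

IsLeaf : ∀ {t} → Pos t → Set
IsLeaf p = isLeafT (subtree p) ≡ true

IsInner : ∀ {t} → Pos t → Set
IsInner p = isLeafT (subtree p) ≡ false

-- x ≼ y : x is an ancestor of y (every node is its own ancestor)
data _≼_ : {t : Tree} → Pos t → Pos t → Set where
  here≼  : ∀ {t} {q : Pos t} → here ≼ q
  there≼ : ∀ {t₁ t₂ ts} {i} {p q : Pos (lookup (t₁ ∷ t₂ ∷ ts) i)} →
           _≼_ {lookup (t₁ ∷ t₂ ∷ ts) i} p q →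
           _≼_ {node t₁ t₂ ts} (there i p) (there i q)

IsLCA : ∀ {t} → Pos t → Pos t → Pos t → Set
IsLCA {t} s x y = s ≼ x × s ≼ y × (∀ (w : Pos t) → w ≼ x → w ≼ y → w ≼ s)

-- w lies on the (unique) tree path from x to y: w is an ancestor of x or y,
-- and every common ancestor of x and y (in particular their LCA) is an ancestor of w.
OnPath : ∀ {t} → Pos t → Pos t → Pos t → Set
OnPath {t} x y w = (w ≼ x ⊎ w ≼ y) × (∀ (z : Pos t) → z ≼ x → z ≼ y → z ≼ w)

-- subsets of nodes (Bool-valued, so membership is proof-irrelevant)
Subset : Tree → Set
Subset t = Pos t → Bool

_∈ₛ_ : ∀ {t} → Pos t → Subset t → Set
p ∈ₛ A = A p ≡ true

Elems : ∀ {t} → Subset t → Set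
Elems {t} A = Σ (Pos t) (λ p → p ∈ₛ A)

record BiColouring (t : Tree) (A B : Subset t) : Set where
  field
    A⊆L      : ∀ p → p ∈ₛ A → IsLeaf p
    B⊆L      : ∀ p → p ∈ₛ B → IsLeaf p
    disjoint : ∀ p → p ∈ₛ A → p ∈ₛ B → ⊥
    sameCard : Elems A ↔ Elems B

Identifies : ∀ {t} → Subset t → Subset t → (S : Pos t → Set) → Set
Identifies {t} A B S =
  Σ (Σ (Pos t) S → Pos t) λ π →
  Σ (Σ (Pos t) S → Pos t) λ σ →
    (∀ s → IsLeaf (π s)) × (∀ s → IsLeaf (σ s)) ×
    (∀ s s' → π s ≡ π s' → proj₁ s ≡ proj₁ s') ×
    (∀ s s' → σ s ≡ σ s' → proj₁ s ≡ proj₁ s') ×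
    (∀ s → IsLCA (proj₁ s) (π s) (σ s)) ×
    (∀ s s' (x : Pos t) → OnPath (π s) (σ s) x → OnPath (π s') (σ s') x →
       proj₁ s ≡ proj₁ s') ×
    (∀ (l : Pos t) → (l ∈ₛ A) ⇔ (∃ λ s → π s ≡ l)) ×
    (∀ (l : Pos t) → (l ∈ₛ B) ⇔ (∃ λ s → σ s ≡ l))

{-# OPTIONS --safe #-}
module Submission where

-- Colour the nodes top-down by ℤ/4: the root gets 0 and the children of a node of
-- colour c get c+1, except the second child, which gets c+2.  The first two children
-- of a node then have distinct colours, both different from their parent's, so from
-- any node one can descend to a leaf through first or second children without ever
-- meeting a given colour j other than that node's own.  An inner node s of colour i
-- is sent by π and σ to the leaves reached in this way from its first and second
-- child, avoiding i.  No node of colour i lies strictly below s on the path between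
-- π(s) and σ(s), so s is the deepest colour-i inner ancestor of every node on that
-- path.  This "owner" recovers s from any node it requests, which gives unique
-- request, injectivity of π and σ, disjointness of their images, the bijection
-- σ ∘ π⁻¹ between them, and makes membership in the images decidable.

open import Defs
open import Axiom.UniquenessOfIdentityProofs.WithK using (uip)
open import Data.Bool using (true; false; if_then_else_) renaming (_≟_ to _≟ᵇ_)
open import Data.Empty using (⊥; ⊥-elim)
open import Data.Fin using (Fin; suc; _↑ˡ_)
open import Data.Fin.Patterns using (0F; 1F; 2F; 3F)
open import Data.Fin.Properties using () renaming (_≟_ to _≟ᶠ_)
open import Data.List using (_∷_; length; lookup)
open import Data.Nat using (_+_)
open import Data.Maybe using (Maybe; just; nothing; map; _<∣>_)
open import Data.Maybe.Properties using (just-injective)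
open import Data.Product using (Σ; ∃; _×_; _,_; proj₁; proj₂)
open import Data.Sum using (inj₁; inj₂; [_,_]′)
open import Function using (_∘_; case_of_)
open import Function.Bundles using (_⇔_; mk⇔; mk↔ₛ′; module Equivalence)
open import Relation.Nullary using (Dec; yes; no; does; ¬_)
open import Relation.Nullary.Decidable using (dec-true; map′; _×-dec_)
open import Relation.Unary using (Decidable)
open import Relation.Binary.PropositionalEquality
  using (_≡_; _≢_; refl; sym; trans; cong; subst; module ≡-Reasoning)

does≡true⇔ : ∀ {a} {A : Set a} (a? : Dec A) → (does a? ≡ true) ⇔ A
does≡true⇔ (yes a)  = mk⇔ (λ _ → a) (λ _ → refl)
does≡true⇔ (no ¬a) = mk⇔ (λ ()) (⊥-elim ∘ ¬a)

inner⇒¬leaf : ∀ {t} {p : Pos t} → IsInner p → ¬ IsLeaf p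
inner⇒¬leaf isInner isLeaf with trans (sym isInner) isLeaf
... | ()

Elems-≡ : ∀ {t} {X : Subset t} {x y : Elems X} → proj₁ x ≡ proj₁ y → x ≡ y
Elems-≡ {x = l , e} {y = .l , e′} refl = cong (l ,_) (uip e e′)

there-injective : ∀ {t₁ t₂ ts i} {p q : Pos (lookup (t₁ ∷ t₂ ∷ ts) i)} →
                  there {t₁} {t₂} {ts} i p ≡ there i q → p ≡ q
there-injective refl = refl

_≟ₚ_ : ∀ {t} (p q : Pos t) → Dec (p ≡ q)
here      ≟ₚ here      = yes refl
here      ≟ₚ there _ _ = no λ ()
there _ _ ≟ₚ here      = no λ ()
there i p ≟ₚ there j q with i ≟ᶠ j
... | no i≢j   = no λ { refl → i≢j refl }
... | yes refl = map′ (cong (there i)) there-injective (p ≟ₚ q)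

≼-refl : ∀ {t} {p : Pos t} → p ≼ p
≼-refl {p = here}      = here≼
≼-refl {p = there i p} = there≼ ≼-refl

≼-trans : ∀ {t} {p q r : Pos t} → p ≼ q → q ≼ r → p ≼ r
≼-trans here≼        _            = here≼
≼-trans (there≼ p≼q) (there≼ q≼r) = there≼ (≼-trans p≼q q≼r)

≼-antisym : ∀ {t} {p q : Pos t} → p ≼ q → q ≼ p → p ≡ q
≼-antisym here≼        here≼        = refl
≼-antisym (there≼ p≼q) (there≼ q≼p) = cong (there _) (≼-antisym p≼q q≼p)

≼-there⁻¹ : ∀ {t₁ t₂ ts i} {p q : Pos (lookup (t₁ ∷ t₂ ∷ ts) i)} →
            there {t₁} {t₂} {ts} i p ≼ there i q → p ≼ q
≼-there⁻¹ (there≼ p≼q) = p≼q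

rootIf : ∀ {t} {P : Pos t → Set} → Decidable P → Maybe (Pos t)
rootIf P? = if does (P? here) then just here else nothing

lowestAncestor : ∀ {t} {P : Pos t → Set} → Decidable P → Pos t → Maybe (Pos t)
lowestAncestor P? here        = rootIf P?
lowestAncestor P? (there j p) = map (there j) (lowestAncestor (P? ∘ there j) p) <∣> rootIf P?

module _ {t : Tree} {P : Pos t → Set} (P? : Decidable P) where

  rootIf-sound : ∀ {s} → rootIf P? ≡ just s → P s × s ≡ here
  rootIf-sound with P? here
  ... | yes Ph = λ { refl → Ph , refl }
  ... | no  _  = λ ()

  rootIf-complete : P here → rootIf P? ≡ just here
  rootIf-complete Ph rewrite dec-true (P? here) Ph = refl

lowestAncestor-sound : ∀ {t} {P : Pos t → Set} (P? : Decidable P) {s x} →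
                       lowestAncestor P? x ≡ just s → P s × s ≼ x
lowestAncestor-sound P? {x = here} found with rootIf-sound P? found
... | Ps , refl = Ps , here≼
lowestAncestor-sound P? {x = there j p} found with lowestAncestor (P? ∘ there j) p in eq
... | nothing with rootIf-sound P? found
...   | Ps , refl = Ps , here≼
lowestAncestor-sound P? {x = there j p} refl | just s =
  let (Ps , s≼p) = lowestAncestor-sound (P? ∘ there j) eq in Ps , there≼ s≼p

lowestAncestor-deepest : ∀ {t} {P : Pos t → Set} (P? : Decidable P) {s x} →
  P s → s ≼ x → (∀ {w} → P w → w ≼ x → w ≼ s) → lowestAncestor P? x ≡ just s
lowestAncestor-deepest P? {x = here} Ps here≼ _ = rootIf-complete P? Ps
lowestAncestor-deepest P? {x = there j p} Ps here≼ deepest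
  with lowestAncestor (P? ∘ there j) p in eq
... | nothing = rootIf-complete P? Ps
... | just w with lowestAncestor-sound (P? ∘ there j) eq
...   | Pw , w≼p with () ← deepest Pw (there≼ w≼p)
lowestAncestor-deepest P? {x = there j p} Ps (there≼ s≼p) deepest
  rewrite lowestAncestor-deepest (P? ∘ there j) Ps s≼p
            (λ Pw w≼p → ≼-there⁻¹ (deepest Pw (there≼ w≼p)))
  = refl

module Identification
  {t : Tree} {S : Pos t → Set} (S? : Decidable S) (π σ : Pos t → Pos t)
  (S⇒inner : ∀ s → S s → IsInner s)
  (π-leaf : ∀ s → S s → IsLeaf (π s))
  (σ-leaf : ∀ s → S s → IsLeaf (σ s))
  (lca : ∀ s → S s → IsLCA s (π s) (σ s))
  (π-arm : ∀ s {w} → S s → S w → w ≼ π s → w ≼ s)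
  (σ-arm : ∀ s {w} → S s → S w → w ≼ σ s → w ≼ s)
  where

  owner : Pos t → Maybe (Pos t)
  owner = lowestAncestor S?

  owner-onPath : ∀ s x → S s → OnPath (π s) (σ s) x → owner x ≡ just s
  owner-onPath s x Ss (x≼end , below) with lca s Ss
  ... | s≼π , s≼σ , _ = lowestAncestor-deepest S? Ss (below s s≼π s≼σ) λ Sw w≼x →
    [ (λ x≼π → π-arm s Ss Sw (≼-trans w≼x x≼π))
    , (λ x≼σ → σ-arm s Ss Sw (≼-trans w≼x x≼σ))
    ]′ x≼end

  owner-π : ∀ s → S s → owner (π s) ≡ just s
  owner-π s Ss = owner-onPath s (π s) Ss (inj₁ ≼-refl , λ _ z≼π _ → z≼π)

  owner-σ : ∀ s → S s → owner (σ s) ≡ just s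
  owner-σ s Ss = owner-onPath s (σ s) Ss (inj₂ ≼-refl , λ _ _ z≼σ → z≼σ)

  owner-unique : ∀ x {s s′} → owner x ≡ just s → owner x ≡ just s′ → s ≡ s′
  owner-unique _ owns owns′ = just-injective (trans (sym owns) owns′)

  π≢σ : ∀ s → S s → π s ≢ σ s
  π≢σ s Ss π≡σ with lca s Ss
  ... | s≼π , _ , lowest =
    inner⇒¬leaf {p = s} (S⇒inner s Ss) (subst IsLeaf (sym s≡π) (π-leaf s Ss))
    where
    s≡π : s ≡ π s
    s≡π = ≼-antisym s≼π (lowest (π s) ≼-refl (subst (π s ≼_) π≡σ ≼-refl))

  module Image (f : Pos t → Pos t) (owner-f : ∀ s → S s → owner (f s) ≡ just s) where

    f-injective : ∀ s s′ → S s → S s′ → f s ≡ f s′ → s ≡ s′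
    f-injective s s′ Ss Ss′ f≡ =
      owner-unique (f s) (owner-f s Ss) (trans (cong owner f≡) (owner-f s′ Ss′))

    image? : ∀ l → Dec (∃ λ (s : Σ (Pos t) S) → f (proj₁ s) ≡ l)
    image? l with owner l in owns
    ... | nothing = no λ { ((s , Ss) , refl) → case trans (sym owns) (owner-f s Ss) of λ () }
    ... | just s with lowestAncestor-sound S? {x = l} owns | f s ≟ₚ l
    ...   | Ss , _ | yes fs≡l = yes ((s , Ss) , fs≡l)
    ...   | Ss , _ | no  fs≢l = no λ { ((s′ , Ss′) , refl) →
                                    fs≢l (cong f (owner-unique l owns (owner-f s′ Ss′))) }

    image : Subset t
    image l = does (image? l)

    ∈-image⇔ : ∀ l → l ∈ₛ image ⇔ (∃ λ s → f (proj₁ s) ≡ l)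
    ∈-image⇔ l = does≡true⇔ (image? l)

    preimage : Elems image → Σ (Pos t) S
    preimage (l , e) = proj₁ (Equivalence.to (∈-image⇔ l) e)

    f-preimage : ∀ y → f (proj₁ (preimage y)) ≡ proj₁ y
    f-preimage (l , e) = proj₂ (Equivalence.to (∈-image⇔ l) e)

    owner-preimage : ∀ y → owner (proj₁ y) ≡ just (proj₁ (preimage y))
    owner-preimage y with preimage y | f-preimage y
    ... | s , Ss | refl = owner-f s Ss

    f∈image : ∀ s → S s → f s ∈ₛ image
    f∈image s Ss = Equivalence.from (∈-image⇔ (f s)) ((s , Ss) , refl)

    image⊆ : ∀ {L : Pos t → Set} → (∀ s → S s → L (f s)) → ∀ l → l ∈ₛ image → L l
    image⊆ f∈L l e with Equivalence.to (∈-image⇔ l) e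
    ... | (s , Ss) , refl = f∈L s Ss

    preimage-f : ∀ s → S s → (e : f s ∈ₛ image) → proj₁ (preimage (f s , e)) ≡ s
    preimage-f s Ss e = owner-unique (f s) (owner-preimage (f s , e)) (owner-f s Ss)

  module A = Image π owner-π
  module B = Image σ owner-σ

  σ∘π⁻¹ : Elems A.image → Elems B.image
  σ∘π⁻¹ y = σ (proj₁ (A.preimage y)) , B.f∈image _ (proj₂ (A.preimage y))

  π∘σ⁻¹ : Elems B.image → Elems A.image
  π∘σ⁻¹ y = π (proj₁ (B.preimage y)) , A.f∈image _ (proj₂ (B.preimage y))

  σ∘π⁻¹-inverseˡ : ∀ y → σ∘π⁻¹ (π∘σ⁻¹ y) ≡ y
  σ∘π⁻¹-inverseˡ y = Elems-≡ (trans (cong σ (A.preimage-f s Ss _)) (B.f-preimage y))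
    where s = proj₁ (B.preimage y)
          Ss = proj₂ (B.preimage y)

  σ∘π⁻¹-inverseʳ : ∀ y → π∘σ⁻¹ (σ∘π⁻¹ y) ≡ y
  σ∘π⁻¹-inverseʳ y = Elems-≡ (trans (cong π (B.preimage-f s Ss _)) (A.f-preimage y))
    where s = proj₁ (A.preimage y)
          Ss = proj₂ (A.preimage y)

  A∩B≡∅ : ∀ l → l ∈ₛ A.image → l ∈ₛ B.image → ⊥
  A∩B≡∅ l ea eb = π≢σ s (proj₂ (A.preimage (l , ea))) (begin
    π s   ≡⟨ A.f-preimage (l , ea) ⟩
    l     ≡⟨ B.f-preimage (l , eb) ⟨
    σ s′  ≡⟨ cong σ (owner-unique l (B.owner-preimage (l , eb)) (A.owner-preimage (l , ea))) ⟩
    σ s   ∎)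
    where
    open ≡-Reasoning
    s = proj₁ (A.preimage (l , ea))
    s′ = proj₁ (B.preimage (l , eb))

  bicolouring : BiColouring t A.image B.image
  bicolouring = record
    { A⊆L      = A.image⊆ π-leaf
    ; B⊆L      = B.image⊆ σ-leaf
    ; disjoint = A∩B≡∅
    ; sameCard = mk↔ₛ′ σ∘π⁻¹ π∘σ⁻¹ σ∘π⁻¹-inverseˡ σ∘π⁻¹-inverseʳ
    }

  identifies : Identifies A.image B.image S
  identifies =
    π ∘ proj₁ , σ ∘ proj₁ ,
    (λ (s , Ss) → π-leaf s Ss) , (λ (s , Ss) → σ-leaf s Ss) ,
    (λ (s , Ss) (s′ , Ss′) → A.f-injective s s′ Ss Ss′) ,
    (λ (s , Ss) (s′ , Ss′) → B.f-injective s s′ Ss Ss′) ,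
    (λ (s , Ss) → lca s Ss) ,
    (λ (s , Ss) (s′ , Ss′) x on on′ →
       owner-unique x (owner-onPath s x Ss on) (owner-onPath s′ x Ss′ on′)) ,
    A.∈-image⇔ , B.∈-image⇔

next : Fin 4 → Fin 4
next 0F = 1F
next 1F = 2F
next 2F = 3F
next 3F = 0F

next-≢ : ∀ c → next c ≢ c
next-≢ 0F ()
next-≢ 1F ()
next-≢ 2F ()
next-≢ 3F ()

next²-≢ : ∀ c → next (next c) ≢ c
next²-≢ 0F ()
next²-≢ 1F ()
next²-≢ 2F ()
next²-≢ 3F ()

childColour : ∀ {n} → Fin 4 → Fin (2 + n) → Fin 4
childColour c 0F            = next c
childColour c 1F            = next (next c)
childColour c (suc (suc _)) = next c

childColour-≢ : ∀ {n} c (i : Fin (2 + n)) → childColour c i ≢ c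
childColour-≢ c 0F            = next-≢ c
childColour-≢ c 1F            = next²-≢ c
childColour-≢ c (suc (suc _)) = next-≢ c

colourAt : ∀ {t} → Fin 4 → Pos t → Fin 4
colourAt c here        = c
colourAt c (there i p) = colourAt (childColour c i) p

leafAvoiding : (t : Tree) → Fin 4 → Fin 4 → Pos t
leafAvoiding leaf             c j = here
leafAvoiding (node t₁ t₂ ts) c j with next c ≟ᶠ j
... | yes _ = there 1F (leafAvoiding t₂ (next (next c)) j)
... | no  _ = there 0F (leafAvoiding t₁ (next c) j)

leafAvoiding-isLeaf : ∀ t c j → IsLeaf (leafAvoiding t c j)
leafAvoiding-isLeaf leaf             c j = refl
leafAvoiding-isLeaf (node t₁ t₂ ts) c j with next c ≟ᶠ j
... | yes _ = leafAvoiding-isLeaf t₂ (next (next c)) j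
... | no  _ = leafAvoiding-isLeaf t₁ (next c) j

leafAvoiding-avoids : ∀ t {c j} → c ≢ j → ∀ {w} → w ≼ leafAvoiding t c j → colourAt c w ≢ j
leafAvoiding-avoids leaf             c≢j here≼ = c≢j
leafAvoiding-avoids (node t₁ t₂ ts) {c} {j} c≢j with next c ≟ᶠ j
... | yes refl = λ { here≼ → c≢j ; (there≼ w≼a) → leafAvoiding-avoids t₂ (next-≢ (next c)) w≼a }
... | no c′≢j  = λ { here≼ → c≢j ; (there≼ w≼a) → leafAvoiding-avoids t₁ c′≢j w≼a }

endpoint : Fin 2 → ∀ {t} → Fin 4 → Pos t → Pos t
endpoint k {leaf}            c here = here
endpoint k {node t₁ t₂ ts} c here =
  there i (leafAvoiding (lookup (t₁ ∷ t₂ ∷ ts) i) (childColour c i) c)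
  where i = k ↑ˡ length ts
endpoint k c (there i p) = there i (endpoint k (childColour c i) p)

endpoint-leaf : ∀ k {t} c (p : Pos t) → IsLeaf (endpoint k c p)
endpoint-leaf k {leaf}            c here        = refl
endpoint-leaf k {node t₁ t₂ ts} c here        =
  leafAvoiding-isLeaf (lookup (t₁ ∷ t₂ ∷ ts) (k ↑ˡ length ts)) (childColour c (k ↑ˡ length ts)) c
endpoint-leaf k                   c (there i p) = endpoint-leaf k (childColour c i) p

endpoint-lca : ∀ {t} c (s : Pos t) → IsInner s → IsLCA s (endpoint 0F c s) (endpoint 1F c s)
endpoint-lca {node _ _ _} c here _ = here≼ , here≼ , λ where
  here          _         _  → here≼
  (there _ _) (there≼ _) ()
endpoint-lca c (there i s) s-inner with endpoint-lca (childColour c i) s s-inner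
... | s≼π , s≼σ , lowest = there≼ s≼π , there≼ s≼σ , λ where
  here          _           _           → here≼
  (there _ w) (there≼ w≼π) (there≼ w≼σ) → there≼ (lowest w w≼π w≼σ)

endpoint-arm : ∀ k {t} c {s w : Pos t} → w ≼ endpoint k c s → colourAt c w ≡ colourAt c s → w ≼ s
endpoint-arm k {leaf}          c {here} here≼ _ = here≼
endpoint-arm k {node _ _ _}    c {here} here≼ _ = here≼
endpoint-arm k {node _ _ ts}   c {here} (there≼ w≼a) same =
  ⊥-elim (leafAvoiding-avoids _ (childColour-≢ c (k ↑ˡ length ts)) w≼a same)
endpoint-arm k c {there i s} here≼ _ = here≼
endpoint-arm k c {there i s} (there≼ w≼e) same =
  there≼ (endpoint-arm k (childColour c i) w≼e same)

corollary3p10 :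
    (t : Tree) →
    Σ (Fin 4 → Subset t) λ A →
    Σ (Fin 4 → Subset t) λ B →
    Σ (Pos t → Fin 4) λ c →
      ((i : Fin 4) → BiColouring t (A i) (B i)) ×
      ((i : Fin 4) → Identifies (A i) (B i) (λ p → IsInner p × c p ≡ i))
corollary3p10 t = ColourClass.A.image , ColourClass.B.image , colourAt 0F ,
                  ColourClass.bicolouring , ColourClass.identifies
  where
  inner? : Decidable (IsInner {t})
  inner? p = isLeafT (subtree p) ≟ᵇ false

  module ColourClass (i : Fin 4) = Identification
    (λ p → inner? p ×-dec (colourAt 0F p ≟ᶠ i)) (endpoint 0F 0F) (endpoint 1F 0F)
    (λ _ → proj₁) (λ s _ → endpoint-leaf 0F 0F s) (λ s _ → endpoint-leaf 1F 0F s)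
    (λ s → endpoint-lca 0F s ∘ proj₁)
    (λ _ (_ , s∈i) (_ , w∈i) w≼π → endpoint-arm 0F 0F w≼π (trans w∈i (sym s∈i)))
    (λ _ (_ , s∈i) (_ , w∈i) w≼σ → endpoint-arm 1F 0F w≼σ (trans w∈i (sym s∈i)))
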